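{- Let $k\ge 1$ and let $H$ be a $2$-connected outerplanar near-triangulation with exactly $k$ triangles (bounded faces). Then $H$ is isomorphic to a minor of $\mathcal{Q}_k$. Furthermore, for every edge $a_1a_2\in E(H)$ incident with the unbounded face, there is a minor model of $H$ in $\mathcal{Q}_k$ such that for each $i\in\{1,2\}$ the vertex $w_i$ belongs to the node of $a_i$, where $w_1w_2$ is the base edge of $\mathcal{Q}_k$.
   Context: All graphs are finite and simple. $\mathcal{Q}_1$ is $K_3$, with an arbitrary edge designated as its base edge. For $i\ge2$, take two disjoint copies $Q_1,Q_2$ of $\mathcal{Q}_{i-1}$ with base edges $u_1v_1$ and $u_2v_2$, and a triangle $T$ on vertices $\{w_1,w_2,w\}$ disjoint from them; $\mathcal{Q}_i$ is obtained from $Q_1\cup Q_2\cup T$ by identifying $u_1$ with $w_1$, $u_2$ with $w_2$, and both $v_1$ and $v_2$ with $w$; the base edge of $\mathcal{Q}_i$ is $w_1w_2$. Here $H$ is drawn in the plane without crossings so that every vertex is incident with the unbounded face (outerplanar) and every face except the unbounded one is bounded by a triangle (near-triangulation); the triangles of $H$ are its bounded faces. A minor model of $H$ in a graph $G$ assigns to each vertex $u$ of $H$ a connected subgraph of $G$, called the node of $u$, such that distinct nodes are vertex-disjoint and for every edge $uv$ of $H$ some edge of $G$ joins the node of $u$ to the node of $v$; $H$ is isomorphic to a minor of $G$ iff such a model exists. -}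

module Defs where

open import Data.Nat as ℕ using (ℕ; zero; suc; _+_; _∸_; _<ᵇ_; _≤_)
open import Data.Fin as Fin using (Fin; toℕ)
open import Data.Bool using (Bool; true; false; _∧_; if_then_else_)
open import Data.Unit using (⊤; tt)
open import Data.Empty using (⊥)
open import Data.Sum using (_⊎_; inj₁; inj₂)
open import Data.Product using (Σ; ∃; _×_; _,_)
open import Data.List using (List; map)
open import Data.Nat.ListAction using (sum)
open import Data.List.Base using (allFin)
open import Relation.Binary.PropositionalEquality using (_≡_; _≢_)
open import Relation.Nullary using (¬_)

data Reach {V : Set} (E : V → V → Set) (S : V → Set) : V → V → Set where
  here : ∀ {x} → S x → Reach E S x x
  step : ∀ {x y z} → S x → E x y → Reach E S y z → Reach E S x z

ConnectedOn : {V : Set} (E : V → V → Set) (S : V → Set) → Set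
ConnectedOn {V} E S = (Σ V S) × (∀ x y → S x → S y → Reach E S x y)

record SimpleGraph (n : ℕ) : Set where
  field
    adj   : Fin n → Fin n → Bool
    sym   : ∀ i j → adj i j ≡ adj j i
    irrefl : ∀ i → adj i i ≡ false

open SimpleGraph public

Adj : ∀ {n} → SimpleGraph n → Fin n → Fin n → Set
Adj H i j = adj H i j ≡ true

TwoConnected : ∀ {n} → SimpleGraph n → Set
TwoConnected {n} H =
  (3 ≤ n) × ConnectedOn (Adj H) (λ _ → ⊤)
          × (∀ v → ConnectedOn (Adj H) (λ x → x ≢ v))

-- Outerplanar drawings, in convex position: every outerplanar drawing
-- places all vertices on the outer face, so (up to equivalence of
-- drawings) vertices lie on a circle in a cyclic order `pos` and edges are
-- straight chords, no two of which cross.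

record ConvexDrawing {n : ℕ} (H : SimpleGraph n) : Set where
  field
    pos     : Fin n → Fin n
    pos-inj : ∀ i j → pos i ≡ pos j → i ≡ j

  StrictlyBetween : Fin n → Fin n → Fin n → Set
  StrictlyBetween a b c =
    (toℕ (pos a) ℕ.< toℕ (pos c) × toℕ (pos c) ℕ.< toℕ (pos b))
    ⊎ (toℕ (pos b) ℕ.< toℕ (pos c) × toℕ (pos c) ℕ.< toℕ (pos a))

  Separates : Fin n → Fin n → Fin n → Fin n → Set
  Separates a b c d =
    StrictlyBetween a b c × ¬ StrictlyBetween a b d × d ≢ a × d ≢ b

  Cross : Fin n → Fin n → Fin n → Fin n → Set
  Cross a b c d = Separates a b c d ⊎ Separates a b d c

  Planar : Set
  Planar = ∀ a b c d → Adj H a b → Adj H c d → ¬ Cross a b c d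

  -- every bounded face is a triangle: for a 2-connected convex drawing the
  -- bounded faces are the regions into which the chords cut the polygon,
  -- and all of them are triangles iff no further chord can be added
  -- without crossing (for non-adjacent a ≠ b, some edge crosses ab)
  AllBoundedFacesTriangles : Set
  AllBoundedFacesTriangles =
    ∀ a b → a ≢ b → adj H a b ≡ false →
      Σ (Fin n) λ c → Σ (Fin n) λ d → Adj H c d × Cross a b c d

  Consecutive : Fin n → Fin n → Set
  Consecutive x y =
    (suc (toℕ (pos x)) ≡ toℕ (pos y))
    ⊎ (suc (toℕ (pos x)) ≡ n × toℕ (pos y) ≡ 0)

  -- edges incident with the unbounded face: the sides of the polygon
  OuterEdge : Fin n → Fin n → Set
  OuterEdge a b = Adj H a b × (Consecutive a b ⊎ Consecutive b a)

open ConvexDrawing public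

record OuterplanarNearTriangulation {n : ℕ} (H : SimpleGraph n) : Set where
  field
    drawing   : ConvexDrawing H
    planar    : Planar drawing
    nearTriang : AllBoundedFacesTriangles drawing

open OuterplanarNearTriangulation public

-- In a convex crossing-free drawing every triangle bounds a bounded face
-- (no vertex lies inside it and no chord can enter it without crossing a
-- side), and in a near-triangulation every bounded face is a triangle, so
-- this is exactly the number of bounded faces.
triangleCount : ∀ {n} → SimpleGraph n → ℕ
triangleCount {n} H =
  sum (map (λ a → sum (map (λ b → sum (map (λ c → f a b c) (allFin n)))
                               (allFin n)))
           (allFin n))
  where
  f : Fin n → Fin n → Fin n → ℕ
  f a b c = if (toℕ a <ᵇ toℕ b) ∧ (toℕ b <ᵇ toℕ c)
                ∧ adj H a b ∧ adj H b c ∧ adj H a c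
            then 1 else 0

-- Convention: Q 0 is K₂ (a single edge, the base edge); applying the
-- recursive construction to two copies of K₂ yields K₃ with base edge
-- w₁w₂, i.e. Q 1 = 𝒬₁.  For k ≥ 1, Q k is exactly the paper's 𝒬_k.
-- Vertices: inj₁ 0 = w₁, inj₁ 1 = w₂ (the base edge), inj₂ _ = the others.

QInner : ℕ → Set
QInner zero    = ⊥
QInner (suc i) = ⊤ ⊎ (Bool × QInner i)   -- w, or an inner vertex of copy b

QV : ℕ → Set
QV i = Fin 2 ⊎ QInner i

w₁ w₂ : ∀ {i} → QV i
w₁ = inj₁ Fin.zero
w₂ = inj₁ (Fin.suc Fin.zero)

wᵀ : ∀ {i} → QV (suc i)
wᵀ = inj₂ (inj₁ tt)

tv : ∀ {i} → Fin 3 → QV (suc i)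
tv Fin.zero                     = w₁
tv (Fin.suc Fin.zero)           = w₂
tv (Fin.suc (Fin.suc Fin.zero)) = wᵀ

ι : ∀ {i} → Bool → QV i → QV (suc i)
ι true  (inj₁ Fin.zero) = w₁
ι false (inj₁ Fin.zero) = w₂
ι b (inj₁ (Fin.suc Fin.zero)) = wᵀ
ι b (inj₂ x) = inj₂ (inj₂ (b , x))

data QE : (i : ℕ) → QV i → QV i → Set where
  base₁₂ : QE zero w₁ w₂
  base₂₁ : QE zero w₂ w₁
  tri    : ∀ {i} (a b : Fin 3) → a ≢ b → QE (suc i) (tv a) (tv b)
  copy   : ∀ {i} (b : Bool) {x y : QV i} → QE i x y → QE (suc i) (ι b x) (ι b y)

record MinorModel {n : ℕ} (H : SimpleGraph n) {V : Set} (E : V → V → Set) : Set₁ where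
  field
    node      : Fin n → V → Set
    connected : ∀ u → ConnectedOn E (node u)
    disjoint  : ∀ u v x → u ≢ v → node u x → node v x → ⊥
    edges     : ∀ u v → Adj H u v →
                Σ V λ x → Σ V λ y → node u x × node v y × E x y

open MinorModel public

IsMinorOf : ∀ {n} → SimpleGraph n → {V : Set} → (V → V → Set) → Set₁
IsMinorOf H E = MinorModel H E

-- Number the vertices along the outer cycle starting at a₂, so that the outer edge a₁a₂
-- joins the first and the last position.  A maximal set of non-crossing chords contains,
-- for every chord i j with j > i + 1, an apex m with chords i m and m j; splitting at these
-- triangles gives a binary tree of triangles.  By induction on the tree, a polygon i … j
-- whose tree has at most t triangles has a minor model in 𝒬_t with i and j in the nodes of
-- w₁ and w₂: 𝒬_{t+1} is two copies of 𝒬_t glued at w, one for i … m and one for m … j,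
-- and w joins the node of m.  Distinct triangles of the tree have distinct vertex sets, so
-- there are at most triangleCount H of them.

module Submission where

open import Defs hiding (sym; connected; disjoint; edges)
open import Algebra.Bundles using (CommutativeRing)
open import Data.Bool as Bool using (Bool; true; false; not; _xor_; _∧_; if_then_else_)
open import Data.Bool.Properties
  using (xor-∧-commutativeRing; xor-same; xor-identityʳ; not-involutive; ¬-not; not-¬)
open import Data.Empty using (⊥; ⊥-elim)
open import Data.Fin as Fin using (Fin; toℕ; fromℕ<)
import Data.Fin.Properties as Finₚ
open import Data.List using (List; []; _∷_; _++_; length; map; cartesianProduct; allFin)
open import Data.List.Properties using (map-++; map-∘; length-map; map-cong; length-++)
open import Data.List.Membership.Propositional using (_∈_)
open import Data.List.Membership.Propositional.Properties using (∈-cartesianProduct⁺; ∈-allFin)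
open import Data.List.Relation.Binary.Subset.Propositional using (_⊆_)
open import Data.List.Relation.Unary.All as All using (All; []; _∷_)
import Data.List.Relation.Unary.All.Properties as Allₚ
open import Data.List.Relation.Unary.Any using (here; there)
open import Data.List.Relation.Unary.AllPairs as AllPairs using (AllPairs; []; _∷_)
import Data.List.Relation.Unary.AllPairs.Properties as AllPairsₚ
open import Data.List.Relation.Unary.Unique.Propositional using (Unique)
open import Data.Nat using (ℕ; zero; suc; _+_; _∸_; _≤_; _<_; _<ᵇ_; z≤n; s≤s; z<s)
open import Data.Nat.ListAction using (sum)
open import Data.Nat.ListAction.Properties using (sum-++)
open import Data.Nat.Properties
open import Data.Product using (Σ; ∃; _×_; _,_; proj₁; proj₂)
open import Data.Sum using (_⊎_; inj₁; inj₂; [_,_]′)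
open import Function.Base using (_∘_; case_of_)
open import Function.Bundles using (_⇔_; mk⇔; Equivalence)
import Function.Properties.Equivalence as ⇔
open import Relation.Binary.PropositionalEquality
open import Relation.Nullary using (¬_; Dec; yes; no)
open import Relation.Unary using (_∪_)
open import Relation.Binary using (tri<; tri≈; tri>)
open import Relation.Nullary.Decidable using (dec-true; dec-false; does-⇔; _×-dec_)
open import Relation.Nullary.Reflects using (ofʸ; ofⁿ)

open import Algebra.Properties.CommutativeSemigroup
  (CommutativeRing.+-commutativeSemigroup xor-∧-commutativeRing) using (interchange)
import Algebra.Properties.CommutativeSemigroup +-commutativeSemigroup as +-CS

<ᵇ-true : ∀ {m n} → m < n → (m <ᵇ n) ≡ true
<ᵇ-true = dec-true (_ <? _)

<ᵇ-false : ∀ {m n} → ¬ m < n → (m <ᵇ n) ≡ false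
<ᵇ-false = dec-false (_ <? _)

<ᵇ-cong : ∀ {m n u v} → (m < n ⇔ u < v) → (m <ᵇ n) ≡ (u <ᵇ v)
<ᵇ-cong m<n⇔u<v = does-⇔ m<n⇔u<v (_ <? _) (_ <? _)

xor-cancelʳ : ∀ k {u v} → u xor k ≡ v xor k → u ≡ v
xor-cancelʳ k {true}  {true}  _ = refl
xor-cancelʳ k {false} {false} _ = refl
xor-cancelʳ k {true}  {false} e = ⊥-elim (not-¬ refl (sym e))
xor-cancelʳ k {false} {true}  e = ⊥-elim (not-¬ refl e)

m+[n∸1+m]≡n∸1 : ∀ m {n} → suc m ≤ n → m + (n ∸ suc m) ≡ n ∸ 1
m+[n∸1+m]≡n∸1 m (s≤s m≤n) = m+[n∸m]≡n m≤n

-- Counting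

module _ {A : Set} (g : A → ℕ) where

  sum-map-remove : ∀ {x ys} → x ∈ ys → Σ (List A) λ zs →
    sum (map g ys) ≡ g x + sum (map g zs) × (∀ {y} → y ∈ ys → y ≢ x → y ∈ zs)
  sum-map-remove {ys = _ ∷ ys} (here refl) =
    ys , refl , λ { (here y≡x) y≢x → ⊥-elim (y≢x y≡x) ; (there y∈ys) _ → y∈ys }
  sum-map-remove {x} {ys = y ∷ _} (there x∈ys) with sum-map-remove x∈ys
  ... | zs , eq , keep =
    y ∷ zs ,
    trans (cong (g y +_) eq) (+-CS.x∙yz≈y∙xz (g y) (g x) _) ,
    λ { (here e) _ → here e ; (there y∈ys) y≢x → there (keep y∈ys y≢x) }

  length≤sum-map : ∀ {xs ys} → Unique xs → xs ⊆ ys → All (λ x → 1 ≤ g x) xs →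
                   length xs ≤ sum (map g ys)
  length≤sum-map {[]}     _              _     _          = z≤n
  length≤sum-map {x ∷ xs} (x∉xs ∷ uniq) xs⊆ys (1≤gx ∷ 1≤g) with sum-map-remove (xs⊆ys (here refl))
  ... | zs , eq , keep =
    subst (suc (length xs) ≤_) (sym eq)
      (+-mono-≤ 1≤gx (length≤sum-map uniq (λ y∈xs → keep (xs⊆ys (there y∈xs)) (≢x y∈xs)) 1≤g))
    where
    ≢x : ∀ {y} → y ∈ xs → y ≢ x
    ≢x y∈xs y≡x = All.lookup x∉xs y∈xs (sym y≡x)

sum-cartesianProduct : ∀ {A B : Set} (g : A × B → ℕ) (xs : List A) (ys : List B) →
  sum (map g (cartesianProduct xs ys)) ≡ sum (map (λ x → sum (map (λ y → g (x , y)) ys)) xs)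
sum-cartesianProduct g []       ys = refl
sum-cartesianProduct g (x ∷ xs) ys = begin
  sum (map g (map (x ,_) ys ++ cartesianProduct xs ys))
    ≡⟨ cong sum (map-++ g (map (x ,_) ys) (cartesianProduct xs ys)) ⟩
  sum (map g (map (x ,_) ys) ++ map g (cartesianProduct xs ys))
    ≡⟨ sum-++ (map g (map (x ,_) ys)) _ ⟩
  sum (map g (map (x ,_) ys)) + sum (map g (cartesianProduct xs ys))
    ≡⟨ cong₂ _+_ (cong sum (sym (map-∘ ys))) (sum-cartesianProduct g xs ys) ⟩
  sum (map (λ y → g (x , y)) ys) + sum (map (λ x → sum (map (λ y → g (x , y)) ys)) xs)
    ∎
  where open ≡-Reasoning

injective⇒surjective : ∀ {n} (f : Fin n → Fin n) → (∀ {x y} → f x ≡ f y → x ≡ y) →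
                       ∀ y → ∃ λ x → f x ≡ y
injective⇒surjective {suc n} f f-inj y with Finₚ.any? (λ x → f x Finₚ.≟ y)
... | yes hit = hit
... | no miss = ⊥-elim (<-irrefl refl (Finₚ.injective⇒≤ {f = g} g-inj))
  where
  -- f misses y, so it factors through Fin n
  g : Fin (suc n) → Fin n
  g x = Fin.punchOut {i = y} {j = f x} λ y≡fx → miss (x , sym y≡fx)
  g-inj : ∀ {a b} → g a ≡ g b → a ≡ b
  g-inj {a} {b} e =
    f-inj (Finₚ.punchOut-injective (λ q → miss (a , sym q)) (λ q → miss (b , sym q)) e)

module _ {X : Set} where

  _∈₃_ : X → X × X × X → Set
  x ∈₃ (a , b , c) = x ≡ a ⊎ x ≡ b ⊎ x ≡ c

  _⊆₃_ : X × X × X → X × X × X → Set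
  (a , b , c) ⊆₃ t = a ∈₃ t × b ∈₃ t × c ∈₃ t

  pattern 1st = inj₁ refl
  pattern 2nd = inj₂ (inj₁ refl)
  pattern 3rd = inj₂ (inj₂ refl)

  ∈₃-⊆₃ : ∀ {x s t} → x ∈₃ s → s ⊆₃ t → x ∈₃ t
  ∈₃-⊆₃ 1st (a∈t , _ , _) = a∈t
  ∈₃-⊆₃ 2nd (_ , b∈t , _) = b∈t
  ∈₃-⊆₃ 3rd (_ , _ , c∈t) = c∈t

  ⊆₃-trans : ∀ {s t u} → s ⊆₃ t → t ⊆₃ u → s ⊆₃ u
  ⊆₃-trans (a∈t , b∈t , c∈t) t⊆u = ∈₃-⊆₃ a∈t t⊆u , ∈₃-⊆₃ b∈t t⊆u , ∈₃-⊆₃ c∈t t⊆u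

map₃ : {X Y : Set} → (X → Y) → X × X × X → Y × Y × Y
map₃ f (a , b , c) = f a , f b , f c

⊆₃-map : {X Y : Set} (f : X → Y) {s t : X × X × X} → s ⊆₃ t → map₃ f s ⊆₃ map₃ f t
⊆₃-map f (a∈t , b∈t , c∈t) = ∈₃-map a∈t , ∈₃-map b∈t , ∈₃-map c∈t
  where
  ∈₃-map : ∀ {x t} → x ∈₃ t → f x ∈₃ map₃ f t
  ∈₃-map 1st = 1st
  ∈₃-map 2nd = 2nd
  ∈₃-map 3rd = 3rd

same-entries⇒same-mid : ∀ {a b c a′ b′ c′} → a < b → b < c → a′ < b′ → b′ < c′ →
  (a , b , c) ⊆₃ (a′ , b′ , c′) → (a′ , b′ , c′) ⊆₃ (a , b , c) → b ≡ b′
same-entries⇒same-mid {a} {b} {c} {a′} {b′} {c′} a<b b<c a′<b′ b′<c′ (a∈ , b∈ , c∈) (a′∈ , _ , c′∈) =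
  middle b∈
  where
  least : ∀ {x a b c} → a < b → b < c → x ∈₃ (a , b , c) → a ≤ x
  least a<b b<c 1st = ≤-refl
  least a<b b<c 2nd = <⇒≤ a<b
  least a<b b<c 3rd = <⇒≤ (<-trans a<b b<c)
  greatest : ∀ {x a b c} → a < b → b < c → x ∈₃ (a , b , c) → x ≤ c
  greatest a<b b<c 1st = <⇒≤ (<-trans a<b b<c)
  greatest a<b b<c 2nd = <⇒≤ b<c
  greatest a<b b<c 3rd = ≤-refl
  a≡a′ = ≤-antisym (least a<b b<c a′∈) (least a′<b′ b′<c′ a∈)
  c≡c′ = ≤-antisym (greatest a′<b′ b′<c′ c∈) (greatest a<b b<c c′∈)
  middle : b ∈₃ (a′ , b′ , c′) → b ≡ b′
  middle (inj₁ b≡a′)        = ⊥-elim (<⇒≢ a<b (trans a≡a′ (sym b≡a′)))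
  middle (inj₂ (inj₁ b≡b′)) = b≡b′
  middle (inj₂ (inj₂ b≡c′)) = ⊥-elim (<⇒≢ b<c (trans b≡c′ (sym c≡c′)))

module _ {n : ℕ} where

  Increasing₃ : Fin n × Fin n × Fin n → Set
  Increasing₃ (a , b , c) = a Fin.< b × b Fin.< c

  sort₃ : (x y z : Fin n) → Σ (Fin n × Fin n × Fin n) λ t →
          x ≢ y → y ≢ z → x ≢ z → Increasing₃ t × t ⊆₃ (x , y , z) × (x , y , z) ⊆₃ t
  sort₃ x y z with Finₚ.<-cmp x y
  ... | tri≈ _ x≡y _ = (x , y , z) , λ x≢y _ _ → ⊥-elim (x≢y x≡y)
  ... | tri< x<y _ _ with Finₚ.<-cmp y z
  ...   | tri< y<z _ _ = (x , y , z) , λ _ _ _ → (x<y , y<z) , (1st , 2nd , 3rd) , (1st , 2nd , 3rd)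
  ...   | tri≈ _ y≡z _ = (x , y , z) , λ _ y≢z _ → ⊥-elim (y≢z y≡z)
  ...   | tri> _ _ z<y with Finₚ.<-cmp x z
  ...     | tri< x<z _ _ = (x , z , y) , λ _ _ _ → (x<z , z<y) , (1st , 3rd , 2nd) , (1st , 3rd , 2nd)
  ...     | tri≈ _ x≡z _ = (x , y , z) , λ _ _ x≢z → ⊥-elim (x≢z x≡z)
  ...     | tri> _ _ z<x = (z , x , y) , λ _ _ _ → (z<x , x<y) , (3rd , 1st , 2nd) , (2nd , 3rd , 1st)
  sort₃ x y z | tri> _ _ y<x with Finₚ.<-cmp x z
  ...   | tri< x<z _ _ = (y , x , z) , λ _ _ _ → (y<x , x<z) , (2nd , 1st , 3rd) , (2nd , 1st , 3rd)
  ...   | tri≈ _ x≡z _ = (x , y , z) , λ _ _ x≢z → ⊥-elim (x≢z x≡z)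
  ...   | tri> _ _ z<x with Finₚ.<-cmp y z
  ...     | tri< y<z _ _ = (y , z , x) , λ _ _ _ → (y<z , z<x) , (2nd , 3rd , 1st) , (3rd , 1st , 2nd)
  ...     | tri≈ _ y≡z _ = (x , y , z) , λ _ y≢z _ → ⊥-elim (y≢z y≡z)
  ...     | tri> _ _ z<y = (z , y , x) , λ _ _ _ → (z<y , y<x) , (3rd , 2nd , 1st) , (3rd , 2nd , 1st)

-- Connectivity

Reach-trans : ∀ {V : Set} {E : V → V → Set} {S : V → Set} {x y z} →
              Reach E S x y → Reach E S y z → Reach E S x z
Reach-trans (here _)     r = r
Reach-trans (step s e q) r = step s e (Reach-trans q r)

Reach-map : ∀ {V W : Set} {E : V → V → Set} {F : W → W → Set} {S : V → Set} {T : W → Set}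
            (f : V → W) → (∀ {x y} → E x y → F (f x) (f y)) → (∀ {x} → S x → T (f x)) →
            ∀ {x y} → Reach E S x y → Reach F T (f x) (f y)
Reach-map f f-edge f-mem (here s)     = here (f-mem s)
Reach-map f f-edge f-mem (step s e r) = step (f-mem s) (f-edge e) (Reach-map f f-edge f-mem r)

Reach-mono : ∀ {V : Set} {E : V → V → Set} {S T : V → Set} →
             (∀ {x} → S x → T x) → ∀ {x y} → Reach E S x y → Reach E T x y
Reach-mono S⊆T = Reach-map (λ x → x) (λ e → e) S⊆T

Image : {V W : Set} → (V → W) → (V → Set) → W → Set
Image f S w = ∃ λ v → S v × f v ≡ w

module _ {V : Set} {E : V → V → Set} where

  ConnectedOn-image : ∀ {W : Set} {F : W → W → Set} {S : V → Set} (f : V → W) →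
                      (∀ {x y} → E x y → F (f x) (f y)) → ConnectedOn E S → ConnectedOn F (Image f S)
  ConnectedOn-image f f-edge ((v , v∈S) , reach) =
    (f v , v , v∈S , refl) ,
    λ { _ _ (x , x∈S , refl) (y , y∈S , refl) →
          Reach-map f f-edge (λ {z} z∈S → z , z∈S , refl) (reach x y x∈S y∈S) }

  ConnectedOn-∪ : ∀ {S T : V → Set} → ConnectedOn E S → ConnectedOn E T →
                  ∃ (λ z → S z × T z) → ConnectedOn E (S ∪ T)
  ConnectedOn-∪ {S} {T} ((v , v∈S) , reachS) (_ , reachT) (z , z∈S , z∈T) = (v , inj₁ v∈S) , reach
    where
    reach : ∀ x y → (S ∪ T) x → (S ∪ T) y → Reach E (S ∪ T) x y
    reach x y (inj₁ x∈S) (inj₁ y∈S) = Reach-mono inj₁ (reachS x y x∈S y∈S)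
    reach x y (inj₂ x∈T) (inj₂ y∈T) = Reach-mono inj₂ (reachT x y x∈T y∈T)
    reach x y (inj₁ x∈S) (inj₂ y∈T) =
      Reach-trans (Reach-mono inj₁ (reachS x z x∈S z∈S)) (Reach-mono inj₂ (reachT z y z∈T y∈T))
    reach x y (inj₂ x∈T) (inj₁ y∈S) =
      Reach-trans (Reach-mono inj₂ (reachT x z x∈T z∈T)) (Reach-mono inj₁ (reachS z y z∈S y∈S))

  ConnectedOn-∪ˡ : ∀ {S T : V → Set} → ConnectedOn E S → (∀ {x} → ¬ T x) → ConnectedOn E (S ∪ T)
  ConnectedOn-∪ˡ ((v , v∈S) , reachS) T-empty =
    (v , inj₁ v∈S) ,
    λ { x y (inj₁ x∈S) (inj₁ y∈S) → Reach-mono inj₁ (reachS x y x∈S y∈S)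
      ; _ _ (inj₂ x∈T) _          → ⊥-elim (T-empty x∈T)
      ; _ _ _          (inj₂ y∈T) → ⊥-elim (T-empty y∈T) }

  ConnectedOn-∪ʳ : ∀ {S T : V → Set} → (∀ {x} → ¬ S x) → ConnectedOn E T → ConnectedOn E (S ∪ T)
  ConnectedOn-∪ʳ S-empty ((v , v∈T) , reachT) =
    (v , inj₂ v∈T) ,
    λ { x y (inj₂ x∈T) (inj₂ y∈T) → Reach-mono inj₂ (reachT x y x∈T y∈T)
      ; _ _ (inj₁ x∈S) _          → ⊥-elim (S-empty x∈S)
      ; _ _ _          (inj₁ y∈S) → ⊥-elim (S-empty y∈S) }

-- The graphs 𝒬

baseVertex : ∀ {t} → Bool → QV t
baseVertex true  = w₁
baseVertex false = w₂

baseVertex-distinct : ∀ {t} b → baseVertex {t} b ≢ baseVertex (not b)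
baseVertex-distinct true  ()
baseVertex-distinct false ()

baseEdge : ∀ t b → QE t (baseVertex b) (baseVertex (not b))
baseEdge zero    true  = base₁₂
baseEdge zero    false = base₂₁
baseEdge (suc t) true  = tri Fin.zero (Fin.suc Fin.zero) λ ()
baseEdge (suc t) false = tri (Fin.suc Fin.zero) Fin.zero λ ()

QE-sym : ∀ {t x y} → QE t x y → QE t y x
QE-sym base₁₂       = base₂₁
QE-sym base₂₁       = base₁₂
QE-sym (tri a b ne) = tri b a λ e → ne (sym e)
QE-sym (copy b e)   = copy b (QE-sym e)

ι-w₁ : ∀ {t} b → ι {t} b w₁ ≡ baseVertex b
ι-w₁ true  = refl
ι-w₁ false = refl

ι-w₂ : ∀ {t} b → ι {t} b w₂ ≡ wᵀ
ι-w₂ true  = refl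
ι-w₂ false = refl

-- Copy b of Q t is a retract of Q (suc t): the other copy collapses onto the apex.
retract : ∀ {t} → Bool → QV (suc t) → QV t
retract true  (inj₁ Fin.zero)                = w₁
retract false (inj₁ Fin.zero)                = w₂
retract true  (inj₁ (Fin.suc Fin.zero))      = w₂
retract false (inj₁ (Fin.suc Fin.zero))      = w₁
retract _     (inj₂ (inj₁ _))                = w₂
retract true  (inj₂ (inj₂ (true  , x)))      = inj₂ x
retract true  (inj₂ (inj₂ (false , _)))      = w₂
retract false (inj₂ (inj₂ (true  , _)))      = w₂
retract false (inj₂ (inj₂ (false , x)))      = inj₂ x

retract-ι : ∀ {t} b (x : QV t) → retract b (ι b x) ≡ x
retract-ι true  (inj₁ Fin.zero)           = refl
retract-ι false (inj₁ Fin.zero)           = refl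
retract-ι true  (inj₁ (Fin.suc Fin.zero)) = refl
retract-ι false (inj₁ (Fin.suc Fin.zero)) = refl
retract-ι true  (inj₂ x)                  = refl
retract-ι false (inj₂ x)                  = refl

retract-ι-not : ∀ {t} b (x : QV t) → retract b (ι (not b) x) ≡ w₂
retract-ι-not true  (inj₁ Fin.zero)           = refl
retract-ι-not false (inj₁ Fin.zero)           = refl
retract-ι-not true  (inj₁ (Fin.suc Fin.zero)) = refl
retract-ι-not false (inj₁ (Fin.suc Fin.zero)) = refl
retract-ι-not true  (inj₂ x)                  = refl
retract-ι-not false (inj₂ x)                  = refl

ι-injective : ∀ {t} b {x y : QV t} → ι b x ≡ ι b y → x ≡ y
ι-injective b {x} {y} e = begin
  x                 ≡⟨ retract-ι b x ⟨
  retract b (ι b x) ≡⟨ cong (retract b) e ⟩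
  retract b (ι b y) ≡⟨ retract-ι b y ⟩
  y                 ∎
  where open ≡-Reasoning

ι-overlap : ∀ {t} b {x y : QV t} → ι b x ≡ ι (not b) y → x ≡ w₂ × y ≡ w₂
ι-overlap b {x} {y} e = x≡w₂ , y≡w₂
  where
  open ≡-Reasoning
  x≡w₂ : x ≡ w₂
  x≡w₂ = begin
    x                       ≡⟨ retract-ι b x ⟨
    retract b (ι b x)       ≡⟨ cong (retract b) e ⟩
    retract b (ι (not b) y) ≡⟨ retract-ι-not b y ⟩
    w₂                      ∎
  y≡w₂ : y ≡ w₂
  y≡w₂ = begin
    y                                   ≡⟨ retract-ι (not b) y ⟨
    retract (not b) (ι (not b) y)       ≡⟨ cong (retract (not b)) e ⟨
    retract (not b) (ι b x)             ≡⟨ cong (λ c → retract (not b) (ι c x)) (not-involutive b) ⟨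
    retract (not b) (ι (not (not b)) x) ≡⟨ retract-ι-not (not b) x ⟩
    w₂                                  ∎

Joined : ∀ {t} → (ℕ → QV t → Set) → ℕ → ℕ → Set
Joined {t} N p q = ∃ λ x → ∃ λ y → N p x × N q y × QE t x y

Joined-sym : ∀ {t} {N : ℕ → QV t → Set} {p q} → Joined N p q → Joined N q p
Joined-sym (x , y , p∋x , q∋y , e) = y , x , q∋y , p∋x , QE-sym e

-- Chords of a convex polygon

Between : ℕ → ℕ → ℕ → Set
Between a b c = (a < c × c < b) ⊎ (b < c × c < a)

Crossing : ℕ → ℕ → ℕ → ℕ → Set
Crossing a b c d = (Between a b c × ¬ Between a b d × d ≢ a × d ≢ b)
                 ⊎ (Between a b d × ¬ Between a b c × c ≢ a × c ≢ b)

betweenᵇ : ℕ → ℕ → ℕ → Bool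
betweenᵇ a b c = (a <ᵇ c) xor (b <ᵇ c)

OppositeSides : ℕ → ℕ → ℕ → ℕ → Set
OppositeSides a b c d = c ≢ a × c ≢ b × d ≢ a × d ≢ b × betweenᵇ a b c ≢ betweenᵇ a b d

Between⇒≢ : ∀ {a b c} → Between a b c → c ≢ a × c ≢ b
Between⇒≢ (inj₁ (a<c , c<b)) = >⇒≢ a<c , <⇒≢ c<b
Between⇒≢ (inj₂ (b<c , c<a)) = <⇒≢ c<a , >⇒≢ b<c

Between⇔betweenᵇ : ∀ {a b c} → c ≢ a → c ≢ b → Between a b c ⇔ (betweenᵇ a b c ≡ true)
Between⇔betweenᵇ {a} {b} {c} c≢a c≢b with a <ᵇ c | <ᵇ-reflects-< a c | b <ᵇ c | <ᵇ-reflects-< b c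
... | true  | ofʸ a<c | true  | ofʸ b<c =
  mk⇔ (λ { (inj₁ (_ , c<b)) → ⊥-elim (<-asym b<c c<b) ; (inj₂ (_ , c<a)) → ⊥-elim (<-asym a<c c<a) })
      λ ()
... | true  | ofʸ a<c | false | ofⁿ b≮c =
  mk⇔ (λ _ → refl) λ _ → inj₁ (a<c , ≤∧≢⇒< (≮⇒≥ b≮c) c≢b)
... | false | ofⁿ a≮c | true  | ofʸ b<c =
  mk⇔ (λ _ → refl) λ _ → inj₂ (b<c , ≤∧≢⇒< (≮⇒≥ a≮c) c≢a)
... | false | ofⁿ a≮c | false | ofⁿ b≮c =
  mk⇔ (λ { (inj₁ (a<c , _)) → ⊥-elim (a≮c a<c) ; (inj₂ (b<c , _)) → ⊥-elim (b≮c b<c) }) λ ()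

Crossing⇔OppositeSides : ∀ {a b c d} → Crossing a b c d ⇔ OppositeSides a b c d
Crossing⇔OppositeSides {a} {b} {c} {d} = mk⇔ to from
  where
  inside : ∀ {x} → Between a b x → betweenᵇ a b x ≡ true
  inside btw = let x≢a , x≢b = Between⇒≢ btw in Equivalence.to (Between⇔betweenᵇ x≢a x≢b) btw
  outside : ∀ {x} → x ≢ a → x ≢ b → ¬ Between a b x → betweenᵇ a b x ≡ false
  outside x≢a x≢b ¬btw = ¬-not λ e → ¬btw (Equivalence.from (Between⇔betweenᵇ x≢a x≢b) e)
  to : Crossing a b c d → OppositeSides a b c d
  to (inj₁ (btw , ¬btw , d≢a , d≢b)) = let c≢a , c≢b = Between⇒≢ btw in
    c≢a , c≢b , d≢a , d≢b , λ e → not-¬ (inside btw) (trans e (outside d≢a d≢b ¬btw))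
  to (inj₂ (btw , ¬btw , c≢a , c≢b)) = let d≢a , d≢b = Between⇒≢ btw in
    c≢a , c≢b , d≢a , d≢b , λ e → not-¬ (inside btw) (trans (sym e) (outside c≢a c≢b ¬btw))
  from : OppositeSides a b c d → Crossing a b c d
  from (c≢a , c≢b , d≢a , d≢b , sides) with betweenᵇ a b c in eq
  ... | true  = inj₁ (Equivalence.from (Between⇔betweenᵇ c≢a c≢b) eq ,
                      (λ btw → sides (sym (inside btw))) , d≢a , d≢b)
  ... | false = inj₂ (Equivalence.from (Between⇔betweenᵇ d≢a d≢b) (¬-not (sides ∘ sym)) ,
                      (λ btw → not-¬ (inside btw) eq) , c≢a , c≢b)

Crossing-resp : ∀ {a b c d a′ b′ c′ d′} → a ≡ a′ → b ≡ b′ → c ≡ c′ → d ≡ d′ →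
                Crossing a b c d → Crossing a′ b′ c′ d′
Crossing-resp refl refl refl refl crossing = crossing

Straddles : ℕ → ℕ → ℕ → ℕ → Set
Straddles a b c d = a < c × c < b × (d < a ⊎ b < d)

Straddles⇒Crossing : ∀ {a b c d} → Straddles a b c d → Crossing a b c d
Straddles⇒Crossing {a} {b} {c} {d} (a<c , c<b , d-out) =
  inj₁ (inj₁ (a<c , c<b) , d-not-between , d≢a d-out , d≢b d-out)
  where
  a<b = <-trans a<c c<b
  d-not-between : ¬ Between a b d
  d-not-between (inj₁ (a<d , d<b)) = [ <-asym a<d , <-asym d<b ]′ d-out
  d-not-between (inj₂ (b<d , d<a)) = <-asym a<b (<-trans b<d d<a)
  d≢a : d < a ⊎ b < d → d ≢ a
  d≢a (inj₁ d<a) = <⇒≢ d<a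
  d≢a (inj₂ b<d) = >⇒≢ (<-trans a<b b<d)
  d≢b : d < a ⊎ b < d → d ≢ b
  d≢b (inj₁ d<a) = <⇒≢ (<-trans d<a a<b)
  d≢b (inj₂ b<d) = >⇒≢ b<d

Between-ordered : ∀ {a b c} → a < b → Between a b c → a < c × c < b
Between-ordered a<b (inj₁ a<c<b)       = a<c<b
Between-ordered a<b (inj₂ (b<c , c<a)) = ⊥-elim (<-asym a<b (<-trans b<c c<a))

not-Between-outside : ∀ {a b d} → ¬ Between a b d → d ≢ a → d ≢ b → d < a ⊎ b < d
not-Between-outside {a} {b} {d} d-out d≢a d≢b with <-cmp d a
... | tri< d<a _ _   = inj₁ d<a
... | tri≈ _ d≡a _   = ⊥-elim (d≢a d≡a)
... | tri> _ _ a<d with <-cmp d b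
...   | tri< d<b _ _ = ⊥-elim (d-out (inj₁ (a<d , d<b)))
...   | tri≈ _ d≡b _ = ⊥-elim (d≢b d≡b)
...   | tri> _ _ b<d = inj₂ b<d

Crossing⇒Straddles : ∀ {a b c d} → a < b → Crossing a b c d → Straddles a b c d ⊎ Straddles a b d c
Crossing⇒Straddles a<b (inj₁ (c-in , d-out , d≢a , d≢b)) =
  let a<c , c<b = Between-ordered a<b c-in in inj₁ (a<c , c<b , not-Between-outside d-out d≢a d≢b)
Crossing⇒Straddles a<b (inj₂ (d-in , c-out , c≢a , c≢b)) =
  let a<d , d<b = Between-ordered a<b d-in in inj₂ (a<d , d<b , not-Between-outside c-out c≢a c≢b)

-- The cyclic relabelling of the positions 0 … n-1 that moves position s to 0.
module Rotation (n s : ℕ) (s≤n : s ≤ n) where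

  rot : ℕ → ℕ
  rot x = if x <ᵇ s then x + (n ∸ s) else x ∸ s

  rot-below : ∀ {x} → x < s → rot x ≡ x + (n ∸ s)
  rot-below x<s rewrite <ᵇ-true x<s = refl

  rot-above : ∀ {x} → s ≤ x → rot x ≡ x ∸ s
  rot-above s≤x rewrite <ᵇ-false (≤⇒≯ s≤x) = refl

  rot<n : ∀ {x} → x < n → rot x < n
  rot<n {x} x<n with x <? s
  ... | yes x<s = subst (_< n) (sym (rot-below x<s))
                    (subst (x + (n ∸ s) <_) (m+[n∸m]≡n s≤n) (+-monoˡ-< (n ∸ s) x<s))
  ... | no  x≮s = subst (_< n) (sym (rot-above (≮⇒≥ x≮s))) (≤-<-trans (m∸n≤m x s) x<n)

  shifted-above<shifted-below : ∀ {x y} → y < n → s ≤ y → y ∸ s < x + (n ∸ s)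
  shifted-above<shifted-below {x} y<n s≤y = <-≤-trans (∸-monoˡ-< y<n s≤y) (m≤n+m (n ∸ s) x)

  rot-injective : ∀ {x y} → x < n → y < n → rot x ≡ rot y → x ≡ y
  rot-injective {x} {y} x<n y<n e with x <? s | y <? s
  ... | yes x<s | yes y<s =
    +-cancelʳ-≡ (n ∸ s) x y (trans (sym (rot-below x<s)) (trans e (rot-below y<s)))
  ... | no  x≮s | no  y≮s =
    ∸-cancelʳ-≡ (≮⇒≥ x≮s) (≮⇒≥ y≮s) (trans (sym (rot-above (≮⇒≥ x≮s))) (trans e (rot-above (≮⇒≥ y≮s))))
  ... | yes x<s | no  y≮s = ⊥-elim (>⇒≢ (shifted-above<shifted-below y<n (≮⇒≥ y≮s))
    (trans (sym (rot-below x<s)) (trans e (rot-above (≮⇒≥ y≮s)))))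
  ... | no  x≮s | yes y<s = ⊥-elim (<⇒≢ (shifted-above<shifted-below x<n (≮⇒≥ x≮s))
    (trans (sym (rot-above (≮⇒≥ x≮s))) (trans e (rot-below y<s))))

  <ᵇ-rot : ∀ {x y} → x < n → y < n →
           (rot x <ᵇ rot y) ≡ (x <ᵇ y) xor ((x <ᵇ s) xor (y <ᵇ s))
  <ᵇ-rot {x} {y} x<n y<n with x <ᵇ s | <ᵇ-reflects-< x s | y <ᵇ s | <ᵇ-reflects-< y s
  ... | true  | ofʸ x<s | true  | ofʸ y<s =
    trans (<ᵇ-cong (mk⇔ (+-cancelʳ-< _ x y) (+-monoˡ-< (n ∸ s)))) (sym (xor-identityʳ _))
  ... | false | ofⁿ x≮s | false | ofⁿ y≮s =
    trans (<ᵇ-cong (mk⇔ (λ h → ≰⇒> λ y≤x → <⇒≱ h (∸-monoˡ-≤ s y≤x))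
                        (λ x<y → ∸-monoˡ-< x<y (≮⇒≥ x≮s))))
          (sym (xor-identityʳ _))
  ... | true  | ofʸ x<s | false | ofⁿ y≮s rewrite <ᵇ-true (<-≤-trans x<s (≮⇒≥ y≮s)) =
    <ᵇ-false (<⇒≯ (shifted-above<shifted-below y<n (≮⇒≥ y≮s)))
  ... | false | ofⁿ x≮s | true  | ofʸ y<s rewrite <ᵇ-false (<⇒≯ (<-≤-trans y<s (≮⇒≥ x≮s))) =
    <ᵇ-true (shifted-above<shifted-below {y} x<n (≮⇒≥ x≮s))

  betweenᵇ-rot : ∀ {a b c} → a < n → b < n → c < n →
    betweenᵇ (rot a) (rot b) (rot c) ≡ betweenᵇ a b c xor ((a <ᵇ s) xor (b <ᵇ s))
  betweenᵇ-rot {a} {b} {c} a<n b<n c<n = begin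
    (rot a <ᵇ rot c) xor (rot b <ᵇ rot c)
      ≡⟨ cong₂ _xor_ (<ᵇ-rot a<n c<n) (<ᵇ-rot b<n c<n) ⟩
    ((a <ᵇ c) xor (ka xor kc)) xor ((b <ᵇ c) xor (kb xor kc))
      ≡⟨ interchange (a <ᵇ c) (ka xor kc) (b <ᵇ c) (kb xor kc) ⟩
    betweenᵇ a b c xor ((ka xor kc) xor (kb xor kc))
      ≡⟨ cong (betweenᵇ a b c xor_) (interchange ka kc kb kc) ⟩
    betweenᵇ a b c xor ((ka xor kb) xor (kc xor kc))
      ≡⟨ cong (λ z → betweenᵇ a b c xor ((ka xor kb) xor z)) (xor-same kc) ⟩
    betweenᵇ a b c xor ((ka xor kb) xor false)
      ≡⟨ cong (betweenᵇ a b c xor_) (xor-identityʳ (ka xor kb)) ⟩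
    betweenᵇ a b c xor (ka xor kb)
      ∎
    where
    open ≡-Reasoning
    ka = a <ᵇ s
    kb = b <ᵇ s
    kc = c <ᵇ s

  -- The rotation flips every side of the chord ab or none, so opposite sides stay opposite.
  OppositeSides-rot : ∀ {a b c d} → a < n → b < n → c < n → d < n →
    OppositeSides (rot a) (rot b) (rot c) (rot d) ⇔ OppositeSides a b c d
  OppositeSides-rot {a} {b} {c} {d} a<n b<n c<n d<n = mk⇔ to from
    where
    k = (a <ᵇ s) xor (b <ᵇ s)
    rot-≢ : ∀ {x y} → x < n → y < n → x ≢ y → rot x ≢ rot y
    rot-≢ x<n y<n x≢y e = x≢y (rot-injective x<n y<n e)
    to : OppositeSides (rot a) (rot b) (rot c) (rot d) → OppositeSides a b c d
    to (c≢a , c≢b , d≢a , d≢b , sides) =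
      c≢a ∘ cong rot , c≢b ∘ cong rot , d≢a ∘ cong rot , d≢b ∘ cong rot ,
      λ e → sides (trans (betweenᵇ-rot a<n b<n c<n)
                         (trans (cong (_xor k) e) (sym (betweenᵇ-rot a<n b<n d<n))))
    from : OppositeSides a b c d → OppositeSides (rot a) (rot b) (rot c) (rot d)
    from (c≢a , c≢b , d≢a , d≢b , sides) =
      rot-≢ c<n a<n c≢a , rot-≢ c<n b<n c≢b , rot-≢ d<n a<n d≢a , rot-≢ d<n b<n d≢b ,
      λ e → sides (xor-cancelʳ k (trans (sym (betweenᵇ-rot a<n b<n c<n))
                                        (trans e (betweenᵇ-rot a<n b<n d<n))))

  Crossing-rot : ∀ {a b c d} → a < n → b < n → c < n → d < n →
    Crossing (rot a) (rot b) (rot c) (rot d) ⇔ Crossing a b c d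
  Crossing-rot a<n b<n c<n d<n =
    ⇔.trans Crossing⇔OppositeSides
            (⇔.trans (OppositeSides-rot a<n b<n c<n d<n) (⇔.sym Crossing⇔OppositeSides))

-- Triangulations of maximal outerplanar polygons and their minor models in 𝒬

module MaximalOuterplanar
  (n : ℕ) (A : ℕ → ℕ → Set) (A? : ∀ p q → Dec (A p q))
  (A-sym : ∀ {p q} → A p q → A q p) (A-irrefl : ∀ {p} → ¬ A p p)
  (A-bounded : ∀ {p q} → A p q → q < n)
  (noncrossing : ∀ {a b c d} → A a b → A c d → ¬ Crossing a b c d)
  (maximal : ∀ {a b} → a < b → b < n → ¬ A a b → ∃ λ c → ∃ λ d → A c d × Crossing a b c d)
  where

  no-straddle : ∀ {a b c d} → A a b → A c d → ¬ Straddles a b c d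
  no-straddle Aab Acd = noncrossing Aab Acd ∘ Straddles⇒Crossing

  straddling-chord : ∀ {a b} → a < b → b < n → ¬ A a b → ∃ λ c → ∃ λ d → A c d × Straddles a b c d
  straddling-chord a<b b<n ¬Aab with maximal a<b b<n ¬Aab
  ... | c , d , Acd , crossing with Crossing⇒Straddles a<b crossing
  ...   | inj₁ straddle = c , d , Acd , straddle
  ...   | inj₂ straddle = d , c , A-sym Acd , straddle

  A-suc : ∀ {p} → suc p < n → A p (suc p)
  A-suc {p} 1+p<n with A? p (suc p)
  ... | yes Ap1+p = Ap1+p
  ... | no ¬Ap1+p with straddling-chord (n<1+n p) 1+p<n ¬Ap1+p
  ...   | _ , _ , _ , p<c , c<1+p , _ = ⊥-elim (<⇒≱ p<c (≤-pred c<1+p))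

  A-first-last : 1 < n → A 0 (n ∸ 1)
  A-first-last 1<n with A? 0 (n ∸ 1)
  ... | yes A0 = A0
  ... | no ¬A0 with straddling-chord (∸-monoˡ-< 1<n ≤-refl) (∸-monoʳ-< z<s (<⇒≤ 1<n)) ¬A0
  ...   | _ , _ , _   , _ , _ , inj₁ ()
  ...   | _ , d , Acd , _ , _ , inj₂ n-1<d =
    ⊥-elim (<⇒≱ (A-bounded Acd) (subst (_≤ d) (m+[n∸m]≡n (<⇒≤ 1<n)) n-1<d))

  Apex : ℕ → ℕ → Set
  Apex i j = ∃ λ m → i < m × m < j × A i m × A m j

  -- Among the chords i u with u < j, follow farther ones until u j is a chord: a chord
  -- separating u from j must leave from i, since it may cross neither i j nor i u.
  apex-from : ∀ fuel {i j u} → j ≤ fuel + u → A i j → i < u → u < j → A i u → Apex i j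
  apex-from zero    j≤u _ _ u<j _ = ⊥-elim (<⇒≱ u<j j≤u)
  apex-from (suc f) {i} {j} {u} j≤1+f+u Aij i<u u<j Aiu with A? u j
  ... | yes Auj = u , i<u , u<j , Aiu , Auj
  ... | no ¬Auj with straddling-chord u<j (A-bounded Aij) ¬Auj
  ...   | c , d , Acd , u<c , c<j , inj₂ j<d =
    ⊥-elim (no-straddle Aij Acd (<-trans i<u u<c , c<j , inj₂ j<d))
  ...   | c , d , Acd , u<c , c<j , inj₁ d<u with <-cmp d i
  ...     | tri< d<i _ _  = ⊥-elim (no-straddle Aij Acd (<-trans i<u u<c , c<j , inj₁ d<i))
  ...     | tri> _ _ i<d  = ⊥-elim (no-straddle Aiu (A-sym Acd) (i<d , d<u , inj₂ u<c))
  ...     | tri≈ _ refl _ =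
    apex-from f (≤-trans j≤1+f+u (subst (_≤ f + c) (+-suc f u) (+-monoʳ-≤ f u<c)))
              Aij (<-trans i<u u<c) c<j (A-sym Acd)

  apex : ∀ {i j} → A i j → suc i < j → Apex i j
  apex {i} {j} Aij 1+i<j =
    apex-from j (m≤m+n j u) Aij (n<1+n i) 1+i<j (A-suc (<-trans 1+i<j (A-bounded Aij)))
    where u = suc i

  data Triangulation : ℕ → ℕ → Set where
    side  : ∀ {i} → Triangulation i (suc i)
    split : ∀ {i m j} → i < m → m < j → A i m → A m j → A i j →
            Triangulation i m → Triangulation m j → Triangulation i j

  size : ∀ {i j} → Triangulation i j → ℕ
  size side                    = 0
  size (split _ _ _ _ _ T₁ T₂) = suc (size T₁ + size T₂)

  triangulate-with : ∀ fuel {i j} → j ≤ fuel + i → A i j → i < j → Triangulation i j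
  triangulate-with zero    j≤i _ i<j = ⊥-elim (<⇒≱ i<j j≤i)
  triangulate-with (suc f) {i} {j} j≤1+f+i Aij i<j with j ≟ suc i
  ... | yes refl = side
  ... | no  j≢1+i with apex Aij (≤∧≢⇒< i<j (j≢1+i ∘ sym))
  ...   | m , i<m , m<j , Aim , Amj =
    split i<m m<j Aim Amj Aij
      (triangulate-with f (≤-pred (≤-trans m<j j≤1+f+i)) Aim i<m)
      (triangulate-with f (≤-trans j≤1+f+i (subst (_≤ f + m) (+-suc f i) (+-monoʳ-≤ f i<m))) Amj m<j)

  triangulate : ∀ {i j} → A i j → i < j → Triangulation i j
  triangulate {i} {j} = triangulate-with j (m≤m+n j i)

  record Triangle : Set where
    constructor triangle
    field
      {first mid last} : ℕ
      first<mid   : first < mid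
      mid<last    : mid < last
      first—mid   : A first mid
      mid—last    : A mid last
      first—last  : A first last

  open Triangle public

  triangles : ∀ {i j} → Triangulation i j → List Triangle
  triangles side                              = []
  triangles (split i<m m<j Aim Amj Aij T₁ T₂) =
    triangle i<m m<j Aim Amj Aij ∷ triangles T₁ ++ triangles T₂

  length-triangles : ∀ {i j} (T : Triangulation i j) → length (triangles T) ≡ size T
  length-triangles side                    = refl
  length-triangles (split _ _ _ _ _ T₁ T₂) =
    cong suc (trans (length-++ (triangles T₁)) (cong₂ _+_ (length-triangles T₁) (length-triangles T₂)))

  mids-inside : ∀ {i j} (T : Triangulation i j) → All (λ Δ → i < mid Δ × mid Δ < j) (triangles T)
  mids-inside side                    = []
  mids-inside (split i<m m<j _ _ _ T₁ T₂) =
    (i<m , m<j) ∷ Allₚ.++⁺ (All.map (λ (i<k , k<m) → i<k , <-trans k<m m<j) (mids-inside T₁))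
                          (All.map (λ (m<k , k<j) → <-trans i<m m<k , k<j) (mids-inside T₂))

  mids-distinct : ∀ {i j} (T : Triangulation i j) → AllPairs (λ Δ Δ′ → mid Δ ≢ mid Δ′) (triangles T)
  mids-distinct side                  = []
  mids-distinct (split _ _ _ _ _ T₁ T₂) =
    Allₚ.++⁺ (All.map (λ (_ , k<m) → >⇒≢ k<m) (mids-inside T₁))
            (All.map (λ (m<k , _) → <⇒≢ m<k) (mids-inside T₂))
    ∷ AllPairsₚ.++⁺ (mids-distinct T₁) (mids-distinct T₂)
        (All.map (λ (_ , k<m) → All.map (λ (m<k′ , _) → <⇒≢ (<-trans k<m m<k′)) (mids-inside T₂))
                 (mids-inside T₁))

  record IntervalModel (i j t : ℕ) (b : Bool) : Set₁ where
    field
      nodeOf     : ℕ → QV t → Set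
      within     : ∀ {p x} → nodeOf p x → i ≤ p × p ≤ j
      connected  : ∀ {p} → i ≤ p → p ≤ j → ConnectedOn (QE t) (nodeOf p)
      disjoint   : ∀ {p q x} → p ≢ q → nodeOf p x → nodeOf q x → ⊥
      edges      : ∀ {p q} → i ≤ p → p ≤ j → i ≤ q → q ≤ j → A p q → Joined nodeOf p q
      first-node : nodeOf i (baseVertex b)
      last-node  : nodeOf j (baseVertex (not b))

    same-node : ∀ {p q x} → nodeOf p x → nodeOf q x → p ≡ q
    same-node {p} {q} p∋x q∋x with p ≟ q
    ... | yes p≡q = p≡q
    ... | no  p≢q = ⊥-elim (disjoint p≢q p∋x q∋x)

  sideModel : ∀ {i} t b → IntervalModel i (suc i) t b
  sideModel {i} t b = record
    { nodeOf     = N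
    ; within     = λ { (inj₁ (refl , _)) → ≤-refl , n≤1+n i ; (inj₂ (refl , _)) → n≤1+n i , ≤-refl }
    ; connected  = N-connected
    ; disjoint   = N-disjoint
    ; edges      = N-edges
    ; first-node = inj₁ (refl , refl)
    ; last-node  = inj₂ (refl , refl)
    }
    where
    N : ℕ → QV t → Set
    N p x = (p ≡ i × x ≡ baseVertex b) ⊎ (p ≡ suc i × x ≡ baseVertex (not b))

    endpoint : ∀ {p} → i ≤ p → p ≤ suc i → p ≡ i ⊎ p ≡ suc i
    endpoint i≤p p≤1+i with m≤n⇒m<n∨m≡n p≤1+i
    ... | inj₁ p<1+i = inj₁ (≤-antisym (≤-pred p<1+i) i≤p)
    ... | inj₂ p≡1+i = inj₂ p≡1+i

    singleton : ∀ {p x y} → N p x → N p y → x ≡ y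
    singleton (inj₁ (_ , refl)) (inj₁ (_ , refl)) = refl
    singleton (inj₂ (_ , refl)) (inj₂ (_ , refl)) = refl
    singleton (inj₁ (refl , _)) (inj₂ (i≡1+i , _)) = ⊥-elim (1+n≢n (sym i≡1+i))
    singleton (inj₂ (refl , _)) (inj₁ (1+i≡i , _)) = ⊥-elim (1+n≢n 1+i≡i)

    N-connected : ∀ {p} → i ≤ p → p ≤ suc i → ConnectedOn (QE t) (N p)
    N-connected {p} i≤p p≤1+i = inhabited (endpoint i≤p p≤1+i) ,
      λ x y p∋x p∋y → subst (Reach (QE t) (N p) x) (singleton p∋x p∋y) (here p∋x)
      where
      inhabited : p ≡ i ⊎ p ≡ suc i → ∃ (N p)
      inhabited (inj₁ p≡i)   = baseVertex b , inj₁ (p≡i , refl)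
      inhabited (inj₂ p≡1+i) = baseVertex (not b) , inj₂ (p≡1+i , refl)

    N-disjoint : ∀ {p q x} → p ≢ q → N p x → N q x → ⊥
    N-disjoint p≢q (inj₁ (refl , _)) (inj₁ (refl , _)) = p≢q refl
    N-disjoint p≢q (inj₂ (refl , _)) (inj₂ (refl , _)) = p≢q refl
    N-disjoint _   (inj₁ (_ , refl)) (inj₂ (_ , x≡b′)) = baseVertex-distinct b x≡b′
    N-disjoint _   (inj₂ (_ , refl)) (inj₁ (_ , x≡b))  = baseVertex-distinct b (sym x≡b)

    N-edges : ∀ {p q} → i ≤ p → p ≤ suc i → i ≤ q → q ≤ suc i → A p q → Joined N p q
    N-edges i≤p p≤1+i i≤q q≤1+i Apq with endpoint i≤p p≤1+i | endpoint i≤q q≤1+i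
    ... | inj₁ refl | inj₁ refl = ⊥-elim (A-irrefl Apq)
    ... | inj₂ refl | inj₂ refl = ⊥-elim (A-irrefl Apq)
    ... | inj₁ refl | inj₂ refl = _ , _ , inj₁ (refl , refl) , inj₂ (refl , refl) , baseEdge t b
    ... | inj₂ refl | inj₁ refl = _ , _ , inj₂ (refl , refl) , inj₁ (refl , refl) , QE-sym (baseEdge t b)

  -- Copy b of Q t in Q (suc t) carries the polygon i … m and copy (not b) carries m … j;
  -- the two copies meet only in the apex w, which both put into the node of m.
  module Glue {i m j t} (b : Bool) (i<m : i < m) (m<j : m < j) (Aim : A i m) (Amj : A m j)
              (L : IntervalModel i m t true) (R : IntervalModel m j t false) where
    private
      module L = IntervalModel L
      module R = IntervalModel R

    N : ℕ → QV (suc t) → Set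
    N p = Image (ι b) (L.nodeOf p) ∪ Image (ι (not b)) (R.nodeOf p)

    N-within : ∀ {p x} → N p x → i ≤ p × p ≤ j
    N-within (inj₁ (_ , p∋y , _)) = let i≤p , p≤m = L.within p∋y in i≤p , ≤-trans p≤m (<⇒≤ m<j)
    N-within (inj₂ (_ , p∋y , _)) = let m≤p , p≤j = R.within p∋y in ≤-trans (<⇒≤ i<m) m≤p , p≤j

    N-first : N i (baseVertex b)
    N-first = inj₁ (w₁ , L.first-node , ι-w₁ b)

    N-last : N j (baseVertex (not b))
    N-last = inj₂ (w₁ , R.last-node , ι-w₁ (not b))

    N-connected : ∀ {p} → i ≤ p → p ≤ j → ConnectedOn (QE (suc t)) (N p)
    N-connected {p} i≤p p≤j with <-cmp p m
    ... | tri< p<m _ _  =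
      ConnectedOn-∪ˡ (ConnectedOn-image (ι b) (copy b) (L.connected i≤p (<⇒≤ p<m)))
                     λ (_ , p∋y , _) → <⇒≱ p<m (proj₁ (R.within p∋y))
    ... | tri> _ _ m<p  =
      ConnectedOn-∪ʳ (λ (_ , p∋y , _) → <⇒≱ m<p (proj₂ (L.within p∋y)))
                     (ConnectedOn-image (ι (not b)) (copy (not b)) (R.connected (<⇒≤ m<p) p≤j))
    ... | tri≈ _ refl _ =
      ConnectedOn-∪ (ConnectedOn-image (ι b) (copy b) (L.connected (<⇒≤ i<m) ≤-refl))
                    (ConnectedOn-image (ι (not b)) (copy (not b)) (R.connected ≤-refl (<⇒≤ m<j)))
                    (wᵀ , (w₂ , L.last-node , ι-w₂ b) , (w₂ , R.first-node , ι-w₂ (not b)))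

    N-same-node : ∀ {p q x} → N p x → N q x → p ≡ q
    N-same-node (inj₁ (_ , p∋y , refl)) (inj₁ (_ , q∋y′ , e)) =
      L.same-node p∋y (subst (L.nodeOf _) (ι-injective b e) q∋y′)
    N-same-node (inj₂ (_ , p∋y , refl)) (inj₂ (_ , q∋y′ , e)) =
      R.same-node p∋y (subst (R.nodeOf _) (ι-injective (not b) e) q∋y′)
    N-same-node (inj₁ (_ , p∋y , refl)) (inj₂ (_ , q∋y′ , e)) with ι-overlap b (sym e)
    ... | refl , refl = trans (L.same-node p∋y L.last-node) (R.same-node R.first-node q∋y′)
    N-same-node (inj₂ (_ , p∋y , refl)) (inj₁ (_ , q∋y′ , e)) with ι-overlap b e
    ... | refl , refl = trans (R.same-node p∋y R.first-node) (L.same-node L.last-node q∋y′)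

    left-edge : ∀ {p q} → i ≤ p → p ≤ m → i ≤ q → q ≤ m → A p q → Joined N p q
    left-edge i≤p p≤m i≤q q≤m Apq with L.edges i≤p p≤m i≤q q≤m Apq
    ... | x , y , p∋x , q∋y , e =
      ι b x , ι b y , inj₁ (x , p∋x , refl) , inj₁ (y , q∋y , refl) , copy b e

    right-edge : ∀ {p q} → m ≤ p → p ≤ j → m ≤ q → q ≤ j → A p q → Joined N p q
    right-edge m≤p p≤j m≤q q≤j Apq with R.edges m≤p p≤j m≤q q≤j Apq
    ... | x , y , p∋x , q∋y , e =
      ι (not b) x , ι (not b) y , inj₂ (x , p∋x , refl) , inj₂ (y , q∋y , refl) , copy (not b) e

    -- a chord jumping over m would cross i m or m j unless it is i j itself
    jump-over-apex : ∀ {p q} → i ≤ p → p < m → m < q → q ≤ j → A p q → p ≡ i × q ≡ j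
    jump-over-apex {p} {q} i≤p p<m m<q q≤j Apq with p ≟ i | q ≟ j
    ... | yes p≡i | yes q≡j = p≡i , q≡j
    ... | no  p≢i | _       = ⊥-elim (no-straddle Aim Apq (≤∧≢⇒< i≤p (p≢i ∘ sym) , p<m , inj₂ m<q))
    ... | _       | no  q≢j = ⊥-elim (no-straddle Amj (A-sym Apq) (m<q , ≤∧≢⇒< q≤j q≢j , inj₁ p<m))

    N-edges-≤ : ∀ {p q} → p ≤ q → i ≤ p → q ≤ j → A p q → Joined N p q
    N-edges-≤ {p} {q} p≤q i≤p q≤j Apq with q ≤? m | p <? m
    ... | yes q≤m | _       = left-edge i≤p (≤-trans p≤q q≤m) (≤-trans i≤p p≤q) q≤m Apq
    ... | no  q≰m | no  p≮m = right-edge (≮⇒≥ p≮m) (≤-trans p≤q q≤j) (≤-trans (≮⇒≥ p≮m) p≤q) q≤j Apq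
    ... | no  q≰m | yes p<m with jump-over-apex i≤p p<m (≰⇒> q≰m) q≤j Apq
    ...   | refl , refl = _ , _ , N-first , N-last , baseEdge (suc t) b

    N-edges : ∀ {p q} → i ≤ p → p ≤ j → i ≤ q → q ≤ j → A p q → Joined N p q
    N-edges {p} {q} i≤p p≤j i≤q q≤j Apq with ≤-total p q
    ... | inj₁ p≤q = N-edges-≤ p≤q i≤p q≤j Apq
    ... | inj₂ q≤p = Joined-sym {N = N} (N-edges-≤ q≤p i≤q p≤j (A-sym Apq))

    glue : IntervalModel i j (suc t) b
    glue = record
      { nodeOf     = N
      ; within     = N-within
      ; connected  = N-connected
      ; disjoint   = λ p≢q p∋x q∋x → p≢q (N-same-node p∋x q∋x)
      ; edges      = N-edges
      ; first-node = N-first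
      ; last-node  = N-last
      }

  modelOf : ∀ {i j t} (T : Triangulation i j) → size T ≤ t → ∀ b → IntervalModel i j t b
  modelOf {t = t} side _ b = sideModel t b
  modelOf (split i<m m<j Aim Amj _ T₁ T₂) (s≤s size≤t) b =
    Glue.glue b i<m m<j Aim Amj (modelOf T₁ (≤-trans (m≤m+n _ _) size≤t) true)
                                (modelOf T₂ (≤-trans (m≤n+m _ _) size≤t) false)

-- Triangles of H

module _ {n : ℕ} (H : SimpleGraph n) where

  Adj-sym : ∀ {u v} → Adj H u v → Adj H v u
  Adj-sym {u} {v} = trans (SimpleGraph.sym H v u)

  Adj-irrefl : ∀ {u} → ¬ Adj H u u
  Adj-irrefl {u} e = case trans (sym e) (irrefl H u) of λ ()

  triangleIndicator : Fin n × Fin n × Fin n → ℕ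
  triangleIndicator (a , b , c) =
    if (toℕ a <ᵇ toℕ b) ∧ (toℕ b <ᵇ toℕ c) ∧ adj H a b ∧ adj H b c ∧ adj H a c then 1 else 0

  triangleCount-flat : triangleCount H ≡
    sum (map triangleIndicator (cartesianProduct (allFin n) (cartesianProduct (allFin n) (allFin n))))
  triangleCount-flat = sym (trans
    (sum-cartesianProduct triangleIndicator (allFin n) _)
    (cong sum (map-cong (λ a → sum-cartesianProduct (λ bc → triangleIndicator (a , bc))
                                                    (allFin n) (allFin n))
                        (allFin n))))

  Adj-∈₃ : ∀ {a b x y z} → a ∈₃ (x , y , z) → b ∈₃ (x , y , z) → a ≢ b →
           Adj H x y → Adj H y z → Adj H x z → Adj H a b
  Adj-∈₃ 1st 1st a≢b _   _   _   = ⊥-elim (a≢b refl)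
  Adj-∈₃ 1st 2nd _   Axy _   _   = Axy
  Adj-∈₃ 1st 3rd _   _   _   Axz = Axz
  Adj-∈₃ 2nd 1st _   Axy _   _   = Adj-sym Axy
  Adj-∈₃ 2nd 2nd a≢b _   _   _   = ⊥-elim (a≢b refl)
  Adj-∈₃ 2nd 3rd _   _   Ayz _   = Ayz
  Adj-∈₃ 3rd 1st _   _   _   Axz = Adj-sym Axz
  Adj-∈₃ 3rd 2nd _   _   Ayz _   = Adj-sym Ayz
  Adj-∈₃ 3rd 3rd a≢b _   _   _   = ⊥-elim (a≢b refl)

  sorted-triangle-counted : ∀ {x y z t} → Adj H x y → Adj H y z → Adj H x z →
    Increasing₃ t → t ⊆₃ (x , y , z) → 1 ≤ triangleIndicator t
  sorted-triangle-counted {t = a , b , c} Axy Ayz Axz (a<b , b<c) (a∈ , b∈ , c∈)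
    rewrite <ᵇ-true a<b | <ᵇ-true b<c
          | Adj-∈₃ a∈ b∈ (Finₚ.<⇒≢ a<b) Axy Ayz Axz
          | Adj-∈₃ b∈ c∈ (Finₚ.<⇒≢ b<c) Axy Ayz Axz
          | Adj-∈₃ a∈ c∈ (Finₚ.<⇒≢ (Finₚ.<-trans a<b b<c)) Axy Ayz Axz = ≤-refl

-- The polygon of the drawing

module _ {n : ℕ} (H : SimpleGraph n) (O : OuterplanarNearTriangulation H) where

  private
    D = drawing O

  position : Fin n → ℕ
  position x = toℕ (pos D x)

  position<n : ∀ x → position x < n
  position<n x = Finₚ.toℕ<n (pos D x)

  position-injective : ∀ {x z} → position x ≡ position z → x ≡ z
  position-injective e = pos-inj D _ _ (Finₚ.toℕ-injective e)

  Cross⇔Crossing : ∀ {a b c d} →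
    Cross D a b c d ⇔ Crossing (position a) (position b) (position c) (position d)
  Cross⇔Crossing {a} {b} {c} {d} = mk⇔ to from
    where
    to : Cross D a b c d → Crossing (position a) (position b) (position c) (position d)
    to (inj₁ (c-in , d-out , d≢a , d≢b)) =
      inj₁ (c-in , d-out , d≢a ∘ position-injective , d≢b ∘ position-injective)
    to (inj₂ (d-in , c-out , c≢a , c≢b)) =
      inj₂ (d-in , c-out , c≢a ∘ position-injective , c≢b ∘ position-injective)
    from : Crossing (position a) (position b) (position c) (position d) → Cross D a b c d
    from (inj₁ (c-in , d-out , d≢a , d≢b)) =
      inj₁ (c-in , d-out , d≢a ∘ cong position , d≢b ∘ cong position)
    from (inj₂ (d-in , c-out , c≢a , c≢b)) =
      inj₂ (d-in , c-out , c≢a ∘ cong position , c≢b ∘ cong position)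

  -- Positions along the outer cycle, counted from y.
  module Rooted (y : Fin n) (1<n : 1 < n) where

    open Rotation n (position y) (<⇒≤ (position<n y))

    P : Fin n → ℕ
    P x = rot (position x)

    P<n : ∀ x → P x < n
    P<n x = rot<n (position<n x)

    P≤n∸1 : ∀ x → P x ≤ n ∸ 1
    P≤n∸1 x = ∸-monoˡ-≤ 1 (P<n x)

    P-injective : ∀ {x z} → P x ≡ P z → x ≡ z
    P-injective e = position-injective (rot-injective (position<n _) (position<n _) e)

    P-surjective : ∀ {p} → p < n → ∃ λ x → P x ≡ p
    P-surjective {p} p<n =
      let x , e = injective⇒surjective Pᶠ Pᶠ-injective (fromℕ< p<n)
      in  x , Finₚ.fromℕ<-injective _ _ (P<n x) p<n e
      where
      Pᶠ : Fin n → Fin n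
      Pᶠ x = fromℕ< (P<n x)
      Pᶠ-injective : ∀ {x z} → Pᶠ x ≡ Pᶠ z → x ≡ z
      Pᶠ-injective e = P-injective (Finₚ.fromℕ<-injective _ _ (P<n _) (P<n _) e)

    P-first : P y ≡ 0
    P-first = trans (rot-above ≤-refl) (n∸n≡0 (position y))

    P-last : ∀ {x} → Consecutive D x y → P x ≡ n ∸ 1
    P-last {x} (inj₁ 1+px≡py) = begin
      rot px                 ≡⟨ rot-below (subst (px <_) 1+px≡py ≤-refl) ⟩
      px + (n ∸ position y)  ≡⟨ cong (λ s → px + (n ∸ s)) 1+px≡py ⟨
      px + (n ∸ suc px)      ≡⟨ m+[n∸1+m]≡n∸1 px (subst (_≤ n) (sym 1+px≡py) (<⇒≤ (position<n y))) ⟩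
      n ∸ 1                  ∎
      where
      open ≡-Reasoning
      px = position x
    P-last {x} (inj₂ (1+px≡n , py≡0)) = begin
      rot px                 ≡⟨ rot-above (subst (_≤ px) (sym py≡0) z≤n) ⟩
      px ∸ position y        ≡⟨ cong (px ∸_) py≡0 ⟩
      px                     ≡⟨ cong (_∸ 1) 1+px≡n ⟩
      n ∸ 1                  ∎
      where
      open ≡-Reasoning
      px = position x

    -- the inverse of P on the positions below n (its value elsewhere is never used)
    σ : ℕ → Fin n
    σ p with p <? n
    ... | yes p<n = proj₁ (P-surjective p<n)
    ... | no  _   = y

    P∘σ : ∀ {p} → p < n → P (σ p) ≡ p
    P∘σ {p} p<n with p <? n
    ... | yes p<n′ = proj₂ (P-surjective p<n′)
    ... | no  p≮n  = ⊥-elim (p≮n p<n)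

    σ∘P : ∀ x → σ (P x) ≡ x
    σ∘P x = P-injective (P∘σ (P<n x))

    σ-injective : ∀ {p q} → p < n → q < n → σ p ≡ σ q → p ≡ q
    σ-injective p<n q<n e = trans (sym (P∘σ p<n)) (trans (cong P e) (P∘σ q<n))

    A : ℕ → ℕ → Set
    A p q = p < n × q < n × Adj H (σ p) (σ q)

    A? : ∀ p q → Dec (A p q)
    A? p q = (p <? n) ×-dec (q <? n) ×-dec (adj H (σ p) (σ q) Bool.≟ true)

    A-sym : ∀ {p q} → A p q → A q p
    A-sym (p<n , q<n , Apq) = q<n , p<n , Adj-sym H Apq

    A-irrefl : ∀ {p} → ¬ A p p
    A-irrefl (_ , _ , App) = Adj-irrefl H App

    A-bounded : ∀ {p q} → A p q → q < n
    A-bounded (_ , q<n , _) = q<n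

    Adj⇒A : ∀ {x z} → Adj H x z → A (P x) (P z)
    Adj⇒A {x} {z} Axz = P<n x , P<n z , subst₂ (Adj H) (sym (σ∘P x)) (sym (σ∘P z)) Axz

    Crossing-P⇔Cross : ∀ {a b c d} → Crossing (P a) (P b) (P c) (P d) ⇔ Cross D a b c d
    Crossing-P⇔Cross {a} {b} {c} {d} =
      ⇔.trans (Crossing-rot (position<n a) (position<n b) (position<n c) (position<n d))
              (⇔.sym Cross⇔Crossing)

    noncrossing : ∀ {a b c d} → A a b → A c d → ¬ Crossing a b c d
    noncrossing (a<n , b<n , Aab) (c<n , d<n , Acd) crossing =
      planar O _ _ _ _ Aab Acd (Equivalence.to Crossing-P⇔Cross
        (Crossing-resp (sym (P∘σ a<n)) (sym (P∘σ b<n)) (sym (P∘σ c<n)) (sym (P∘σ d<n)) crossing))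

    maximal : ∀ {a b} → a < b → b < n → ¬ A a b → ∃ λ c → ∃ λ d → A c d × Crossing a b c d
    maximal {a} {b} a<b b<n ¬Aab
      with nearTriang O (σ a) (σ b) (<⇒≢ a<b ∘ σ-injective (<-trans a<b b<n) b<n)
                      (¬-not λ Aσaσb → ¬Aab (<-trans a<b b<n , b<n , Aσaσb))
    ... | x , z , Axz , cross =
      P x , P z , Adj⇒A Axz ,
      Crossing-resp (P∘σ (<-trans a<b b<n)) (P∘σ b<n) refl refl
                    (Equivalence.from Crossing-P⇔Cross cross)

    open MaximalOuterplanar n A A? A-sym A-irrefl A-bounded noncrossing maximal

    polygon : Triangulation 0 (n ∸ 1)
    polygon = triangulate (A-first-last 1<n) (∸-monoˡ-< 1<n ≤-refl)

    corners : Triangle → ℕ × ℕ × ℕ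
    corners Δ = first Δ , mid Δ , last Δ

    -- a triangle of the polygon as it is counted in triangleCount H
    key : Triangle → Fin n × Fin n × Fin n
    key Δ = proj₁ (sort₃ (σ (first Δ)) (σ (mid Δ)) (σ (last Δ)))

    key-spec : ∀ Δ →
      Increasing₃ (key Δ) × key Δ ⊆₃ map₃ σ (corners Δ) × map₃ σ (corners Δ) ⊆₃ key Δ
    key-spec Δ = proj₂ (sort₃ (σ (first Δ)) (σ (mid Δ)) (σ (last Δ)))
      (σ-≢ f<n m<n (first<mid Δ)) (σ-≢ m<n l<n (mid<last Δ))
      (σ-≢ f<n l<n (<-trans (first<mid Δ) (mid<last Δ)))
      where
      f<n = proj₁ (first—mid Δ)
      m<n = proj₁ (mid—last Δ)
      l<n = proj₁ (proj₂ (mid—last Δ))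
      σ-≢ : ∀ {p q} → p < n → q < n → p < q → σ p ≢ σ q
      σ-≢ p<n q<n p<q = <⇒≢ p<q ∘ σ-injective p<n q<n

    key-counted : ∀ Δ → 1 ≤ triangleIndicator H (key Δ)
    key-counted Δ = let increasing , key⊆ , _ = key-spec Δ in
      sorted-triangle-counted H (proj₂ (proj₂ (first—mid Δ))) (proj₂ (proj₂ (mid—last Δ)))
                                (proj₂ (proj₂ (first—last Δ))) increasing key⊆

    P∘σ-corners : ∀ Δ → map₃ P (map₃ σ (corners Δ)) ≡ corners Δ
    P∘σ-corners Δ = cong₂ _,_ (P∘σ (proj₁ (first—mid Δ)))
                              (cong₂ _,_ (P∘σ (proj₁ (mid—last Δ))) (P∘σ (proj₁ (proj₂ (mid—last Δ)))))

    same-key⇒corners-⊆₃ : ∀ Δ Δ′ → key Δ ≡ key Δ′ → corners Δ ⊆₃ corners Δ′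
    same-key⇒corners-⊆₃ Δ Δ′ e =
      subst₂ _⊆₃_ (P∘σ-corners Δ) (P∘σ-corners Δ′)
        (⊆₃-map P (⊆₃-trans (proj₂ (proj₂ (key-spec Δ)))
                            (subst (_⊆₃ map₃ σ (corners Δ′)) (sym e) (proj₁ (proj₂ (key-spec Δ′))))))

    same-key⇒same-mid : ∀ Δ Δ′ → key Δ ≡ key Δ′ → mid Δ ≡ mid Δ′
    same-key⇒same-mid Δ Δ′ e =
      same-entries⇒same-mid (first<mid Δ) (mid<last Δ) (first<mid Δ′) (mid<last Δ′)
        (same-key⇒corners-⊆₃ Δ Δ′ e) (same-key⇒corners-⊆₃ Δ′ Δ (sym e))

    size≤triangleCount : size polygon ≤ triangleCount H
    size≤triangleCount =
      subst₂ _≤_ (trans (length-map key (triangles polygon)) (length-triangles polygon))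
                 (sym (triangleCount-flat H))
        (length≤sum-map (triangleIndicator H)
          (AllPairsₚ.map⁺ (AllPairs.map (λ {Δ} {Δ′} mids≢ → mids≢ ∘ same-key⇒same-mid Δ Δ′)
                                        (mids-distinct polygon)))
          (λ _ → ∈-cartesianProduct⁺ (∈-allFin _) (∈-cartesianProduct⁺ (∈-allFin _) (∈-allFin _)))
          (Allₚ.map⁺ (All.tabulate λ {Δ} _ → key-counted Δ)))

    toMinorModel : ∀ {t b} → IntervalModel 0 (n ∸ 1) t b → MinorModel H (QE t)
    toMinorModel M = record
      { node      = λ u → nodeOf (P u)
      ; connected = λ u → connected z≤n (P≤n∸1 u)
      ; disjoint  = λ u v x u≢v → disjoint (u≢v ∘ P-injective)
      ; edges     = λ u v Auv → edges z≤n (P≤n∸1 u) z≤n (P≤n∸1 v) (Adj⇒A Auv)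
      }
      where open IntervalModel M

    minorModel : MinorModel H (QE (triangleCount H))
    minorModel = toMinorModel (modelOf polygon size≤triangleCount true)

    rootedMinorModel : ∀ {x} → Consecutive D x y → ∀ b →
      Σ (MinorModel H (QE (triangleCount H))) λ M →
        node M y (baseVertex b) × node M x (baseVertex (not b))
    rootedMinorModel x→y b =
      toMinorModel M ,
      subst (λ p → nodeOf p (baseVertex b)) (sym P-first) first-node ,
      subst (λ p → nodeOf p (baseVertex (not b))) (sym (P-last x→y)) last-node
      where
      M = modelOf polygon size≤triangleCount b
      open IntervalModel M

lemma2p3 : (k : ℕ) → 1 ≤ k → (n : ℕ) → (H : SimpleGraph n) →
    TwoConnected H → (O : OuterplanarNearTriangulation H) →
    triangleCount H ≡ k →
    IsMinorOf H (QE k)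
    × ((a₁ a₂ : Fin n) → OuterEdge (drawing O) a₁ a₂ →
       Σ (MinorModel H (QE k)) λ M → node M a₁ w₁ × node M a₂ w₂)
lemma2p3 _ _ n H (3≤n , _) O refl = Rooted.minorModel H O y₀ 1<n , outer
  where
  1<n : 1 < n
  1<n = ≤-trans (s≤s (s≤s z≤n)) 3≤n
  y₀ : Fin n
  y₀ = fromℕ< (<-trans z<s 1<n)
  outer : (a₁ a₂ : Fin n) → OuterEdge (drawing O) a₁ a₂ →
          Σ (MinorModel H (QE (triangleCount H))) λ M → node M a₁ w₁ × node M a₂ w₂
  outer a₁ a₂ (_ , inj₁ a₁→a₂) =
    let M , a₂∈w₂ , a₁∈w₁ = Rooted.rootedMinorModel H O a₂ 1<n a₁→a₂ false in M , a₁∈w₁ , a₂∈w₂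
  outer a₁ a₂ (_ , inj₂ a₂→a₁) = Rooted.rootedMinorModel H O a₁ 1<n a₂→a₁ true
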